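{- Let $(x_n^t)_{n\in\mathbb{Z},\,t\ge 0}$ be the rule 150 elementary cellular automaton started from a single seed ($x_n^0=1$ if $n=0$, $x_n^0=0$ otherwise, and $x_n^{t+1}=(x_{n-1}^t+x_n^t+x_{n+1}^t)\bmod 2$), and let $X(t)=\sum_{n\in\mathbb{Z}}x_n^t$. Then for every integer $m\ge 0$ and every $r\in\{0,1,2,3\}$, $$X(8m+r)=X(r)\cdot X(m).$$ (In binary digits $t=\sum_j\sigma_j2^j$: whenever $\sigma_2=0$, $X(\sigma_n\cdots\sigma_3\,0\,\sigma_1\sigma_0)=X(\sigma_1\sigma_0)\,X(\sigma_n\cdots\sigma_3)$.) -}

module Defs where

open import Data.Bool using (Bool; true; false; _xor_; if_then_else_)
open import Data.Nat using (ℕ; zero; suc; _+_)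
open import Data.Integer using (ℤ; +_; -[1+_]; _-_; 0ℤ; 1ℤ) renaming (_+_ to _+ℤ_)
open import Data.Integer.Base using (-_)
open import Relation.Nullary.Decidable using (does)
open import Data.Integer.Properties using (_≟_)

-- Rule 150 cellular automaton from a single seed at 0:
-- cell n ∈ ℤ at time t, value in Bool (true = 1), addition mod 2 = xor.
cell : ℕ → ℤ → Bool
cell zero    n = does (n ≟ 0ℤ)
cell (suc t) n = cell t (n - 1ℤ) xor (cell t n xor cell t (n +ℤ 1ℤ))

countFrom : ℕ → ℤ → ℕ → ℕ
countFrom t a zero    = 0
countFrom t a (suc k) = (if cell t a then 1 else 0) + countFrom t (a +ℤ 1ℤ) k

-- X(t) = Σ_{n∈ℤ} x_n^t.  At time t the configuration is supported in
-- [-t, t] (light cone), so the sum over ℤ equals the sum over the 2t+1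
-- cells -t, …, t.
X : ℕ → ℕ
X t = countFrom t (- (+ t)) (suc (t + t))

{-# OPTIONS --safe #-}
-- Rule 150 is linear over 𝔽₂ with symbol 1 + x + x², and (1 + x + x²)² = 1 + x² + x⁴. Hence
-- 2^e steps act on each residue class mod 2^e as a single step acts on ℤ: the configuration at
-- time 2^e·m is the one at time m dilated by 2^e. In r further steps each seed 2^e·k spreads
-- over its light cone of radius r only, so while 2r + 1 < 2^e the cones stay in disjoint blocks
-- and x(2^e·m + r, z + 2^e·k) = x(m, k)·x(r, z). For 2^e = 8 and r ≤ 3, summing over the blocks
-- [8k − 4, 8k + 4) gives X(8m + r) = X(r)·X(m).
module Submission where

open import Defs
open import Data.Nat using (ℕ; _+_; _*_; _<_)
open import Relation.Binary.PropositionalEquality using (_≡_)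

open import Data.Bool using (Bool; true; false; _xor_; _∧_; if_then_else_)
open import Data.Bool.Properties using (xor-assoc; xor-comm; xor-same; ∧-distribʳ-xor)
open import Data.Nat using (zero; suc; _≤_; _∸_; _^_; NonZero; s≤s; s≤s⁻¹; z≤n)
import Data.Nat.Properties as ℕ
open import Data.Nat.Tactic.RingSolver using () renaming (solve-∀ to ℕ-solve-∀)
open import Data.Integer
  using (ℤ; +_; -[1+_]; +0; +[1+_]; ∣_∣; _⊖_; 0ℤ; 1ℤ; -1ℤ; -_)
  renaming (_+_ to _+ℤ_; _*_ to _*ℤ_; _-_ to _-ℤ_)
import Data.Integer.Properties as ℤ
open import Data.Integer.Tactic.RingSolver using (solve-∀)
open import Data.Sum using (inj₁; inj₂)
open import Relation.Binary.PropositionalEquality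
  using (refl; sym; trans; cong; cong₂; subst; module ≡-Reasoning)

Config : Set
Config = ℤ → Bool

step : Config → Config
step f n = f (n -ℤ 1ℤ) xor (f n xor f (n +ℤ 1ℤ))

evolve : ℕ → Config → Config
evolve zero    f = f
evolve (suc t) f = step (evolve t f)

step-cong : ∀ (f g : Config) {n m} →
            f (n -ℤ 1ℤ) ≡ g (m -ℤ 1ℤ) → f n ≡ g m → f (n +ℤ 1ℤ) ≡ g (m +ℤ 1ℤ) →
            step f n ≡ step g m
step-cong f g l c r = cong₂ _xor_ l (cong₂ _xor_ c r)

evolve-cong : ∀ {f g : Config} → (∀ z → f z ≡ g z) → ∀ t n → evolve t f n ≡ evolve t g n
evolve-cong f≗g zero    n = f≗g n
evolve-cong {f} {g} f≗g (suc t) n =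
  step-cong (evolve t f) (evolve t g) (evolve-cong f≗g t _) (evolve-cong f≗g t n) (evolve-cong f≗g t _)

evolve-translate : ∀ t (f : Config) a i → evolve t (λ j → f (a +ℤ j)) i ≡ evolve t f (a +ℤ i)
evolve-translate zero    f a i = refl
evolve-translate (suc t) f a i = step-cong (evolve t (λ j → f (a +ℤ j))) (evolve t f)
  (trans (evolve-translate t f a _) (cong (evolve t f) (sym (ℤ.+-assoc a i -1ℤ))))
  (evolve-translate t f a i)
  (trans (evolve-translate t f a _) (cong (evolve t f) (sym (ℤ.+-assoc a i 1ℤ))))

step-∧ : ∀ (f : Config) b n → step (λ z → f z ∧ b) n ≡ step f n ∧ b
step-∧ f b n = begin
  (f (n -ℤ 1ℤ) ∧ b) xor ((f n ∧ b) xor (f (n +ℤ 1ℤ) ∧ b))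
    ≡⟨ cong ((f (n -ℤ 1ℤ) ∧ b) xor_) (sym (∧-distribʳ-xor b (f n) (f (n +ℤ 1ℤ)))) ⟩
  (f (n -ℤ 1ℤ) ∧ b) xor ((f n xor f (n +ℤ 1ℤ)) ∧ b)
    ≡⟨ sym (∧-distribʳ-xor b (f (n -ℤ 1ℤ)) (f n xor f (n +ℤ 1ℤ))) ⟩
  step f n ∧ b ∎
  where open ≡-Reasoning

evolve-∧ : ∀ t (f : Config) b n → evolve t (λ z → f z ∧ b) n ≡ evolve t f n ∧ b
evolve-∧ zero    f b n = refl
evolve-∧ (suc t) f b n = trans
  (step-cong (evolve t (λ z → f z ∧ b)) (λ z → evolve t f z ∧ b) (evolve-∧ t f b _) (evolve-∧ t f b n) (evolve-∧ t f b _))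
  (step-∧ (evolve t f) b n)

xor-cancel : ∀ a s b → (a xor s) xor (s xor b) ≡ a xor b
xor-cancel a s b = begin
  (a xor s) xor (s xor b) ≡⟨ xor-assoc a s _ ⟩
  a xor (s xor (s xor b)) ≡⟨ cong (a xor_) (sym (xor-assoc s s b)) ⟩
  a xor ((s xor s) xor b) ≡⟨ cong (λ c → a xor (c xor b)) (xor-same s) ⟩
  a xor b                 ∎
  where open ≡-Reasoning

-- (1 + x + x²)² = 1 + x² + x⁴ over 𝔽₂.
xor-square : ∀ u v w x y →
  (u xor (v xor w)) xor ((v xor (w xor x)) xor (w xor (x xor y))) ≡ u xor (w xor y)
xor-square u v w x y = begin
  (u xor (v xor w)) xor ((v xor (w xor x)) xor (w xor (x xor y)))
    ≡⟨ cong (λ c → (u xor (v xor w)) xor ((v xor (w xor x)) xor c)) (sym (xor-assoc w x y)) ⟩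
  (u xor (v xor w)) xor ((v xor (w xor x)) xor ((w xor x) xor y))
    ≡⟨ cong ((u xor (v xor w)) xor_) (xor-cancel v (w xor x) y) ⟩
  (u xor (v xor w)) xor (v xor y)
    ≡⟨ cong (λ c → (u xor c) xor (v xor y)) (xor-comm v w) ⟩
  (u xor (w xor v)) xor (v xor y)
    ≡⟨ cong (_xor (v xor y)) (sym (xor-assoc u w v)) ⟩
  ((u xor w) xor v) xor (v xor y)
    ≡⟨ xor-cancel (u xor w) v y ⟩
  (u xor w) xor y
    ≡⟨ xor-assoc u w y ⟩
  u xor (w xor y) ∎
  where open ≡-Reasoning

step² : ∀ (f : Config) n → step (step f) n ≡ f (n -ℤ + 2) xor (f n xor f (n +ℤ + 2))
step² f n = begin
  step (step f) n
    ≡⟨ cong₂ _xor_ (cong₂ (λ a b → f a xor (f (n -ℤ 1ℤ) xor f b)) (n-1-1 n) (n-1+1 n))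
                   (cong (step f n xor_) (cong₂ (λ a b → f a xor (f (n +ℤ 1ℤ) xor f b)) (n+1-1 n) (n+1+1 n))) ⟩
  (f (n -ℤ + 2) xor (f (n -ℤ 1ℤ) xor f n)) xor (step f n xor (f n xor (f (n +ℤ 1ℤ) xor f (n +ℤ + 2))))
    ≡⟨ xor-square (f (n -ℤ + 2)) (f (n -ℤ 1ℤ)) (f n) (f (n +ℤ 1ℤ)) (f (n +ℤ + 2)) ⟩
  f (n -ℤ + 2) xor (f n xor f (n +ℤ + 2)) ∎
  where
  open ≡-Reasoning
  n-1-1 : ∀ n → (n -ℤ 1ℤ) -ℤ 1ℤ ≡ n -ℤ + 2
  n-1-1 = solve-∀
  n-1+1 : ∀ n → (n -ℤ 1ℤ) +ℤ 1ℤ ≡ n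
  n-1+1 = solve-∀
  n+1-1 : ∀ n → (n +ℤ 1ℤ) -ℤ 1ℤ ≡ n
  n+1-1 = solve-∀
  n+1+1 : ∀ n → (n +ℤ 1ℤ) +ℤ 1ℤ ≡ n +ℤ + 2
  n+1+1 = solve-∀

evolve-2* : ∀ t (f : Config) n → evolve (2 * t) f n ≡ evolve t (λ j → f (n +ℤ + 2 *ℤ j)) 0ℤ
evolve-2* zero    f n = cong f (sym (ℤ.+-identityʳ n))
evolve-2* (suc t) f n = begin
  evolve (2 * suc t) f n                   ≡⟨ cong (λ s → evolve s f n) (ℕ.*-suc 2 t) ⟩
  step (step E) n                          ≡⟨ step² E n ⟩
  E (n -ℤ + 2) xor (E n xor E (n +ℤ + 2))  ≡⟨ cong₂ _xor_ (on-sublattice -1ℤ) (cong₂ _xor_ (evolve-2* t f n) (on-sublattice 1ℤ)) ⟩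
  step (evolve t h) 0ℤ                     ∎
  where
  open ≡-Reasoning
  E : Config
  E = evolve (2 * t) f
  h : Config
  h j = f (n +ℤ + 2 *ℤ j)
  regroup : ∀ n d j → (n +ℤ + 2 *ℤ d) +ℤ + 2 *ℤ j ≡ n +ℤ + 2 *ℤ (d +ℤ j)
  regroup = solve-∀
  on-sublattice : ∀ d → E (n +ℤ + 2 *ℤ d) ≡ evolve t h d
  on-sublattice d = begin
    E (n +ℤ + 2 *ℤ d)                                ≡⟨ evolve-2* t f _ ⟩
    evolve t (λ j → f ((n +ℤ + 2 *ℤ d) +ℤ + 2 *ℤ j)) 0ℤ ≡⟨ evolve-cong (λ j → cong f (regroup n d j)) t 0ℤ ⟩
    evolve t (λ j → h (d +ℤ j)) 0ℤ                   ≡⟨ evolve-translate t h d 0ℤ ⟩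
    evolve t h (d +ℤ 0ℤ)                             ≡⟨ cong (evolve t h) (ℤ.+-identityʳ d) ⟩
    evolve t h d                                     ∎

evolve-2^* : ∀ e t (f : Config) n → evolve (2 ^ e * t) f n ≡ evolve t (λ j → f (n +ℤ + (2 ^ e) *ℤ j)) 0ℤ
evolve-2^* zero t f n = begin
  evolve (1 * t) f n                           ≡⟨ cong (λ s → evolve s f n) (ℕ.*-identityˡ t) ⟩
  evolve t f n                                 ≡⟨ cong (evolve t f) (sym (ℤ.+-identityʳ n)) ⟩
  evolve t f (n +ℤ 0ℤ)                         ≡⟨ sym (evolve-translate t f n 0ℤ) ⟩
  evolve t (λ j → f (n +ℤ j)) 0ℤ               ≡⟨ evolve-cong (λ j → cong (λ i → f (n +ℤ i)) (sym (ℤ.*-identityˡ j))) t 0ℤ ⟩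
  evolve t (λ j → f (n +ℤ + 1 *ℤ j)) 0ℤ        ∎
  where open ≡-Reasoning
evolve-2^* (suc e) t f n = begin
  evolve (2 ^ suc e * t) f n                   ≡⟨ cong (λ s → evolve s f n) (ℕ.*-assoc 2 (2 ^ e) t) ⟩
  evolve (2 * (2 ^ e * t)) f n                 ≡⟨ evolve-2* (2 ^ e * t) f n ⟩
  evolve (2 ^ e * t) h 0ℤ                      ≡⟨ evolve-2^* e t h 0ℤ ⟩
  evolve t (λ j → h (0ℤ +ℤ + (2 ^ e) *ℤ j)) 0ℤ  ≡⟨ evolve-cong (λ j → cong (λ i → f (n +ℤ i)) (strides j)) t 0ℤ ⟩
  evolve t (λ j → f (n +ℤ + (2 ^ suc e) *ℤ j)) 0ℤ ∎
  where
  open ≡-Reasoning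
  h : Config
  h j = f (n +ℤ + 2 *ℤ j)
  strides : ∀ j → + 2 *ℤ (0ℤ +ℤ + (2 ^ e) *ℤ j) ≡ + (2 ^ suc e) *ℤ j
  strides j = begin
    + 2 *ℤ (0ℤ +ℤ + (2 ^ e) *ℤ j) ≡⟨ cong (+ 2 *ℤ_) (ℤ.+-identityˡ _) ⟩
    + 2 *ℤ (+ (2 ^ e) *ℤ j)       ≡⟨ sym (ℤ.*-assoc (+ 2) (+ (2 ^ e)) j) ⟩
    + 2 *ℤ + (2 ^ e) *ℤ j         ≡⟨ cong (_*ℤ j) (sym (ℤ.pos-* 2 (2 ^ e))) ⟩
    + (2 ^ suc e) *ℤ j            ∎

evolve-cell : ∀ t s n → evolve t (cell s) n ≡ cell (t + s) n
evolve-cell zero    s n = refl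
evolve-cell (suc t) s n =
  step-cong (evolve t (cell s)) (cell (t + s)) (evolve-cell t s _) (evolve-cell t s n) (evolve-cell t s _)

∣i∣≤∣i+j∣+∣j∣ : ∀ i j → ∣ i ∣ ≤ ∣ i +ℤ j ∣ + ∣ j ∣
∣i∣≤∣i+j∣+∣j∣ i j = subst (λ k → ∣ k ∣ ≤ ∣ i +ℤ j ∣ + ∣ j ∣) (i+j-j≡i i j) (ℤ.∣i-j∣≤∣i∣+∣j∣ (i +ℤ j) j)
  where
  i+j-j≡i : ∀ i j → (i +ℤ j) -ℤ j ≡ i
  i+j-j≡i = solve-∀

cell-outside-lightCone : ∀ t n → t < ∣ n ∣ → cell t n ≡ false
cell-outside-lightCone zero    +0       ()
cell-outside-lightCone zero    +[1+ _ ] _ = refl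
cell-outside-lightCone zero    -[1+ _ ] _ = refl
cell-outside-lightCone (suc t) n 1+t<∣n∣ = cong₂ _xor_ (outside -1ℤ refl) (cong₂ _xor_
  (cell-outside-lightCone t n (ℕ.<⇒≤ 1+t<∣n∣)) (outside 1ℤ refl))
  where
  outside : ∀ d → ∣ d ∣ ≡ 1 → cell t (n +ℤ d) ≡ false
  outside d ∣d∣≡1 = cell-outside-lightCone t (n +ℤ d) (s≤s⁻¹ (subst (suc t <_)
    (trans (cong (_+_ ∣ n +ℤ d ∣) ∣d∣≡1) (ℕ.+-comm _ 1))
    (ℕ.<-≤-trans 1+t<∣n∣ (∣i∣≤∣i+j∣+∣j∣ n d))))

translate-outside-lightCone : ∀ {t p} z j .{{_ : NonZero ∣ j ∣}} → ∣ z ∣ + t < p → t < ∣ z +ℤ + p *ℤ j ∣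
translate-outside-lightCone {t} {p} z j ∣z∣+t<p = ℕ.+-cancelˡ-< ∣ z ∣ t _ (begin-strict
  ∣ z ∣ + t                   <⟨ ∣z∣+t<p ⟩
  p                           ≤⟨ ℕ.m≤m*n p ∣ j ∣ ⟩
  p * ∣ j ∣                   ≡⟨ ℤ.∣i*j∣≡∣i∣*∣j∣ (+ p) j ⟨
  ∣ + p *ℤ j ∣                ≤⟨ ∣i∣≤∣i+j∣+∣j∣ (+ p *ℤ j) z ⟩
  ∣ + p *ℤ j +ℤ z ∣ + ∣ z ∣   ≡⟨ ℕ.+-comm _ ∣ z ∣ ⟩
  ∣ z ∣ + ∣ + p *ℤ j +ℤ z ∣   ≡⟨ cong (λ i → ∣ z ∣ + ∣ i ∣) (ℤ.+-comm _ z) ⟩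
  ∣ z ∣ + ∣ z +ℤ + p *ℤ j ∣   ∎)
  where open ℕ.≤-Reasoning

cell-on-lattice : ∀ t p z j → ∣ z ∣ + t < p → cell t (z +ℤ + p *ℤ j) ≡ cell 0 j ∧ cell t z
cell-on-lattice t p z +0 _ =
  cong (cell t) (trans (cong (z +ℤ_) (ℤ.*-zeroʳ (+ p))) (ℤ.+-identityʳ z))
cell-on-lattice t p z j@(+[1+ _ ]) ∣z∣+t<p = cell-outside-lightCone t _ (translate-outside-lightCone z j ∣z∣+t<p)
cell-on-lattice t p z j@(-[1+ _ ]) ∣z∣+t<p = cell-outside-lightCone t _ (translate-outside-lightCone z j ∣z∣+t<p)

cell-2^*+ : ∀ e m r z k → ∣ z ∣ + r < 2 ^ e →
            cell (2 ^ e * m + r) (z +ℤ + (2 ^ e) *ℤ k) ≡ cell m k ∧ cell r z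
cell-2^*+ e m r z k ∣z∣+r<2^e = begin
  cell (2 ^ e * m + r) (z +ℤ P k)                   ≡⟨ evolve-cell (2 ^ e * m) r _ ⟨
  evolve (2 ^ e * m) (cell r) (z +ℤ P k)            ≡⟨ evolve-2^* e m (cell r) _ ⟩
  evolve m (λ j → cell r ((z +ℤ P k) +ℤ P j)) 0ℤ    ≡⟨ evolve-cong on-lattice m 0ℤ ⟩
  evolve m (λ j → cell 0 (k +ℤ j) ∧ cell r z) 0ℤ    ≡⟨ evolve-∧ m (λ j → cell 0 (k +ℤ j)) (cell r z) 0ℤ ⟩
  evolve m (λ j → cell 0 (k +ℤ j)) 0ℤ ∧ cell r z    ≡⟨ cong (_∧ cell r z) seed ⟩
  cell m k ∧ cell r z                               ∎
  where
  open ≡-Reasoning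
  P : ℤ → ℤ
  P j = + (2 ^ e) *ℤ j
  on-lattice : ∀ j → cell r ((z +ℤ P k) +ℤ P j) ≡ cell 0 (k +ℤ j) ∧ cell r z
  on-lattice j = begin
    cell r ((z +ℤ P k) +ℤ P j) ≡⟨ cong (cell r) (ℤ.+-assoc z (P k) (P j)) ⟩
    cell r (z +ℤ (P k +ℤ P j)) ≡⟨ cong (λ i → cell r (z +ℤ i)) (ℤ.*-distribˡ-+ (+ (2 ^ e)) k j) ⟨
    cell r (z +ℤ P (k +ℤ j))   ≡⟨ cell-on-lattice r (2 ^ e) z (k +ℤ j) ∣z∣+r<2^e ⟩
    cell 0 (k +ℤ j) ∧ cell r z ∎
  seed : evolve m (λ j → cell 0 (k +ℤ j)) 0ℤ ≡ cell m k
  seed = begin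
    evolve m (λ j → cell 0 (k +ℤ j)) 0ℤ ≡⟨ evolve-translate m (cell 0) k 0ℤ ⟩
    evolve m (cell 0) (k +ℤ 0ℤ)         ≡⟨ evolve-cell m 0 _ ⟩
    cell (m + 0) (k +ℤ 0ℤ)              ≡⟨ cong₂ cell (ℕ.+-identityʳ m) (ℤ.+-identityʳ k) ⟩
    cell m k                            ∎

count : Config → ℤ → ℕ → ℕ
count f a zero    = 0
count f a (suc n) = (if f a then 1 else 0) + count f (a +ℤ 1ℤ) n

countFrom≡count : ∀ t a n → countFrom t a n ≡ count (cell t) a n
countFrom≡count t a zero    = refl
countFrom≡count t a (suc n) = cong (_+_ _) (countFrom≡count t (a +ℤ 1ℤ) n)

count-cong : ∀ {f g : Config} a b n → (∀ i → i < n → f (a +ℤ + i) ≡ g (b +ℤ + i)) →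
             count f a n ≡ count g b n
count-cong a b zero    _  = refl
count-cong {f} {g} a b (suc n) f≗g = cong₂ (λ x c → (if x then 1 else 0) + c)
  (trans (cong f (sym (ℤ.+-identityʳ a))) (trans (f≗g 0 (s≤s z≤n)) (cong g (ℤ.+-identityʳ b))))
  (count-cong (a +ℤ 1ℤ) (b +ℤ 1ℤ) n λ i i<n →
    trans (cong f (ℤ.+-assoc a 1ℤ (+ i)))
          (trans (f≗g (suc i) (s≤s i<n)) (cong g (sym (ℤ.+-assoc b 1ℤ (+ i))))))

count-++ : ∀ f a m n → count f a (m + n) ≡ count f a m + count f (a +ℤ + m) n
count-++ f a zero    n = cong (λ b → count f b n) (sym (ℤ.+-identityʳ a))
count-++ f a (suc m) n = begin
  (if f a then 1 else 0) + count f (a +ℤ 1ℤ) (m + n)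
    ≡⟨ cong (_+_ _) (count-++ f (a +ℤ 1ℤ) m n) ⟩
  (if f a then 1 else 0) + (count f (a +ℤ 1ℤ) m + count f ((a +ℤ 1ℤ) +ℤ + m) n)
    ≡⟨ cong (λ b → (if f a then 1 else 0) + (count f (a +ℤ 1ℤ) m + count f b n)) (ℤ.+-assoc a 1ℤ (+ m)) ⟩
  (if f a then 1 else 0) + (count f (a +ℤ 1ℤ) m + count f (a +ℤ + suc m) n)
    ≡⟨ ℕ.+-assoc (if f a then 1 else 0) _ _ ⟨
  count f a (suc m) + count f (a +ℤ + suc m) n ∎
  where open ≡-Reasoning

count-false : ∀ a n → count (λ _ → false) a n ≡ 0
count-false a zero    = refl
count-false a (suc n) = count-false (a +ℤ 1ℤ) n

count-∧ˡ : ∀ b (f : Config) a n → count (λ z → b ∧ f z) a n ≡ (if b then count f a n else 0)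
count-∧ˡ true  f a n = refl
count-∧ˡ false f a n = count-false a n

if-then-else-0 : ∀ b c → (if b then c else 0) ≡ c * (if b then 1 else 0)
if-then-else-0 true  c = sym (ℕ.*-identityʳ c)
if-then-else-0 false c = sym (ℕ.*-zeroʳ c)

count-blocks : ∀ {f g : Config} p c a →
               (∀ k → count f (a +ℤ + p *ℤ k) p ≡ (if g k then c else 0)) →
               ∀ k K → count f (a +ℤ + p *ℤ k) (K * p) ≡ c * count g k K
count-blocks p c a block k zero = sym (ℕ.*-zeroʳ c)
count-blocks {f} {g} p c a block k (suc K) = begin
  count f (a +ℤ + p *ℤ k) (p + K * p)
    ≡⟨ count-++ f _ p (K * p) ⟩
  count f (a +ℤ + p *ℤ k) p + count f ((a +ℤ + p *ℤ k) +ℤ + p) (K * p)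
    ≡⟨ cong₂ _+_ (block k) (cong (λ b → count f b (K * p)) (next-block a (+ p) k)) ⟩
  (if g k then c else 0) + count f (a +ℤ + p *ℤ (k +ℤ 1ℤ)) (K * p)
    ≡⟨ cong₂ _+_ (if-then-else-0 (g k) c) (count-blocks p c a block (k +ℤ 1ℤ) K) ⟩
  c * (if g k then 1 else 0) + c * count g (k +ℤ 1ℤ) K
    ≡⟨ ℕ.*-distribˡ-+ c _ _ ⟨
  c * count g k (suc K) ∎
  where
  open ≡-Reasoning
  next-block : ∀ a p k → (a +ℤ p *ℤ k) +ℤ p ≡ a +ℤ p *ℤ (k +ℤ 1ℤ)
  next-block = solve-∀

count-left-of-lightCone : ∀ t p → count (cell t) (- + (t + p)) p ≡ 0
count-left-of-lightCone t zero    = refl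
count-left-of-lightCone t (suc p) = cong₂ (λ x c → (if x then 1 else 0) + c)
  (cell-outside-lightCone t _ outside)
  (trans (cong (λ a → count (cell t) a p) next) (count-left-of-lightCone t p))
  where
  outside : t < ∣ - + (t + suc p) ∣
  outside = subst (t <_) (sym (ℤ.∣-i∣≡∣i∣ (+ (t + suc p)))) (ℕ.m<m+n t (s≤s z≤n))
  -[1+x]+1≡-x : ∀ x → - (1ℤ +ℤ x) +ℤ 1ℤ ≡ - x
  -[1+x]+1≡-x = solve-∀
  next : - + (t + suc p) +ℤ 1ℤ ≡ - + (t + p)
  next = trans (cong (λ x → - + x +ℤ 1ℤ) (ℕ.+-suc t p)) (-[1+x]+1≡-x (+ (t + p)))

count-right-of-lightCone : ∀ t d q → count (cell t) (+ suc (d + t)) q ≡ 0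
count-right-of-lightCone t d zero    = refl
count-right-of-lightCone t d (suc q) = cong₂ (λ x c → (if x then 1 else 0) + c)
  (cell-outside-lightCone t _ (s≤s (ℕ.m≤n+m t d)))
  (trans (cong (λ a → count (cell t) (+ a) q) (ℕ.+-comm (suc (d + t)) 1))
         (count-right-of-lightCone t (suc d) q))

X-window : ∀ t p q → count (cell t) (- + (t + p)) (p + suc (t + t) + q) ≡ X t
X-window t p q = begin
  count (cell t) (- + (t + p)) (p + suc (t + t) + q)
    ≡⟨ cong (count (cell t) _) (ℕ.+-assoc p _ q) ⟩
  count (cell t) (- + (t + p)) (p + (suc (t + t) + q))
    ≡⟨ count-++ (cell t) _ p _ ⟩
  count (cell t) (- + (t + p)) p + count (cell t) (- + (t + p) +ℤ + p) (suc (t + t) + q)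
    ≡⟨ cong₂ _+_ (count-left-of-lightCone t p) (cong (λ a → count (cell t) a (suc (t + t) + q)) (-[t+p]+p≡-t (+ t) (+ p))) ⟩
  count (cell t) (- + t) (suc (t + t) + q)
    ≡⟨ count-++ (cell t) _ (suc (t + t)) q ⟩
  count (cell t) (- + t) (suc (t + t)) + count (cell t) (- + t +ℤ + suc (t + t)) q
    ≡⟨ cong₂ _+_ (sym (countFrom≡count t (- + t) (suc (t + t)))) (cong (λ a → count (cell t) a q) (-t+[1+2t]≡1+t (+ t))) ⟩
  X t + count (cell t) (+ suc t) q
    ≡⟨ cong (_+_ (X t)) (count-right-of-lightCone t 0 q) ⟩
  X t + 0
    ≡⟨ ℕ.+-identityʳ _ ⟩
  X t ∎
  where
  open ≡-Reasoning
  -[t+p]+p≡-t : ∀ t p → - (t +ℤ p) +ℤ p ≡ - t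
  -[t+p]+p≡-t = solve-∀
  -t+[1+2t]≡1+t : ∀ t → - t +ℤ (1ℤ +ℤ (t +ℤ t)) ≡ 1ℤ +ℤ t
  -t+[1+2t]≡1+t = solve-∀

-- The blocks [8k − 4, 8k + 4), −m ≤ k ≤ m, cover the light cone [−(8m + r), 8m + r] with p cells
-- to spare on the left and q on the right.
X-as-blocks : ∀ m r p q → r + p ≡ 4 → r + q ≡ 3 →
              X (8 * m + r) ≡ count (cell (8 * m + r)) (-[1+ 3 ] +ℤ + 8 *ℤ - + m) (suc (m + m) * 8)
X-as-blocks m r p q r+p≡4 r+q≡3 =
  trans (sym (X-window T p q)) (cong₂ (count (cell T)) start length)
  where
  open ≡-Reasoning
  T : ℕ
  T = 8 * m + r
  -[8m+4]≡-4+8[-m] : ∀ m → - (+ 8 *ℤ m +ℤ + 4) ≡ -[1+ 3 ] +ℤ + 8 *ℤ - m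
  -[8m+4]≡-4+8[-m] = solve-∀
  start : - + (T + p) ≡ -[1+ 3 ] +ℤ + 8 *ℤ - + m
  start = begin
    - + (8 * m + r + p)       ≡⟨ cong (λ n → - + n) (trans (ℕ.+-assoc (8 * m) r p) (cong (_+_ (8 * m)) r+p≡4)) ⟩
    - + (8 * m + 4)           ≡⟨ cong -_ (trans (ℤ.pos-+ (8 * m) 4) (cong (_+ℤ + 4) (ℤ.pos-* 8 m))) ⟩
    - (+ 8 *ℤ + m +ℤ + 4)     ≡⟨ -[8m+4]≡-4+8[-m] (+ m) ⟩
    -[1+ 3 ] +ℤ + 8 *ℤ - + m  ∎
  regroup : ∀ m r p q → p + suc ((8 * m + r) + (8 * m + r)) + q ≡ (r + p) + (r + q) + suc ((m + m) * 8)
  regroup = ℕ-solve-∀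
  length : p + suc (T + T) + q ≡ suc (m + m) * 8
  length = trans (regroup m r p q) (cong₂ (λ x y → x + y + suc ((m + m) * 8)) r+p≡4 r+q≡3)

∣m⊖n∣≤n : ∀ {m n} → m ≤ n + n → ∣ m ⊖ n ∣ ≤ n
∣m⊖n∣≤n {m} {n} m≤2n with ℕ.≤-total m n
... | inj₁ m≤n = ℕ.≤-trans (ℕ.≤-reflexive (ℤ.∣⊖∣-≤ m≤n)) (ℕ.m∸n≤m n m)
... | inj₂ n≤m = begin
  ∣ m ⊖ n ∣  ≡⟨ ℤ.∣m⊖n∣≡∣n⊖m∣ m n ⟩
  ∣ n ⊖ m ∣  ≡⟨ ℤ.∣⊖∣-≤ n≤m ⟩
  m ∸ n      ≤⟨ ℕ.∸-monoˡ-≤ n m≤2n ⟩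
  n + n ∸ n  ≡⟨ ℕ.m+n∸n≡m n n ⟩
  n          ∎
  where open ℕ.≤-Reasoning

block-count : ∀ m r → r < 4 → ∀ k →
              count (cell (8 * m + r)) (-[1+ 3 ] +ℤ + 8 *ℤ k) 8
              ≡ (if cell m k then count (cell r) -[1+ 3 ] 8 else 0)
block-count m r r<4 k = trans
  (count-cong {cell (8 * m + r)} {λ z → cell m k ∧ cell r z} _ -[1+ 3 ] 8 in-block)
  (count-∧ˡ (cell m k) (cell r) -[1+ 3 ] 8)
  where
  swap : ∀ a b c → (a +ℤ b) +ℤ c ≡ (a +ℤ c) +ℤ b
  swap = solve-∀
  in-block : ∀ i → i < 8 →
             cell (8 * m + r) ((-[1+ 3 ] +ℤ + 8 *ℤ k) +ℤ + i) ≡ cell m k ∧ cell r (-[1+ 3 ] +ℤ + i)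
  in-block i i<8 = trans (cong (cell (8 * m + r)) (swap -[1+ 3 ] (+ 8 *ℤ k) (+ i)))
    (cell-2^*+ 3 m r (-[1+ 3 ] +ℤ + i) k (ℕ.+-mono-≤-< (∣m⊖n∣≤n {n = 4} (ℕ.<⇒≤ i<8)) r<4))

mainTheorem3 : (m r : ℕ) → r < 4 → X (8 * m + r) ≡ X r * X m
mainTheorem3 m r r<4 = begin
  X (8 * m + r)
    ≡⟨ X-as-blocks m r p q r+p≡4 r+q≡3 ⟩
  count (cell (8 * m + r)) (-[1+ 3 ] +ℤ + 8 *ℤ - + m) (suc (m + m) * 8)
    ≡⟨ count-blocks {cell (8 * m + r)} {cell m} 8 _ -[1+ 3 ] (block-count m r r<4) (- + m) (suc (m + m)) ⟩
  count (cell r) -[1+ 3 ] 8 * count (cell m) (- + m) (suc (m + m))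
    -- for m = 0 there is a single block, and X-as-blocks reads X r ≡ count (cell r) -[1+ 3 ] 8
    ≡⟨ cong₂ _*_ (X-as-blocks 0 r p q r+p≡4 r+q≡3) (countFrom≡count m (- + m) (suc (m + m))) ⟨
  X r * X m ∎
  where
  open ≡-Reasoning
  p q : ℕ
  p = 4 ∸ r
  q = 3 ∸ r
  r+p≡4 : r + p ≡ 4
  r+p≡4 = ℕ.m+[n∸m]≡n (ℕ.<⇒≤ r<4)
  r+q≡3 : r + q ≡ 3
  r+q≡3 = ℕ.m+[n∸m]≡n (s≤s⁻¹ r<4)
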